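{- If $G$ is an Eulerian ribbon graph (embedded graph), then there is a subset $I\subseteq E(G)$ such that the partial Petrial $G^{\tau(I)}$ is checkerboard colourable.
   Context: A ribbon graph $G$ is a surface with boundary built from vertex discs and edge discs, each edge disc meeting vertex discs in exactly two disjoint segments; it is equivalent to a cellularly embedded graph, whose faces are the boundary components of the ribbon graph. $G$ is Eulerian if every vertex has even degree. For an edge $e$, removing from $\partial e$ its two segments of intersection with vertices leaves two arcs (edge line segments); $G$ is checkerboard colourable if the faces can be coloured red/blue so that for each edge the faces containing its two edge line segments get different colours. For $A\subseteq E(G)$, the partial Petrial $G^{\tau(A)}$ is obtained from $G$ by adding a half-twist to each edge in $A$. -}

module Defs where

-- Ribbon graphs are encoded combinatorially as graph-encoded maps
-- (flag systems): a finite set of flags Fin n with three fixed-point-free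
-- involutions t0, t1, t2 such that t0 and t2 commute and t0∘t2 is
-- fixed-point-free.  Each flag is a corner of an edge disc at a vertex:
--   * t0 moves to the other end of the edge, same side (same edge line segment),
--   * t2 moves to the other side of the edge, same end,
--   * t1 moves to the neighbouring edge end around the vertex, same face.
-- vertices = <t1,t2>-orbits, edges = <t0,t2>-orbits, faces (boundary
-- components) = <t0,t1>-orbits.  An edge line segment of an edge is a pair
-- {f , t0 f}; the two edge line segments of the edge of f are {f, t0 f} and
-- {t2 f, t0 (t2 f)}.

open import Data.Nat using (ℕ; zero; suc; _<_)
open import Data.Nat.Divisibility using (_∣_)
open import Data.Fin using (Fin)
open import Data.Bool using (Bool; true; false; if_then_else_)
open import Data.Sum using (_⊎_)
open import Data.Product using (Σ; _×_; ∃)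
open import Relation.Binary.PropositionalEquality
open import Relation.Binary.Construct.Closure.ReflexiveTransitive using (Star)
open import Relation.Nullary using (¬_)

record RibbonGraph (n : ℕ) : Set where
  field
    t0 t1 t2 : Fin n → Fin n
    inv0 : ∀ f → t0 (t0 f) ≡ f
    inv1 : ∀ f → t1 (t1 f) ≡ f
    inv2 : ∀ f → t2 (t2 f) ≡ f
    fpf0 : ∀ f → ¬ (t0 f ≡ f)
    fpf1 : ∀ f → ¬ (t1 f ≡ f)
    fpf2 : ∀ f → ¬ (t2 f ≡ f)
    comm02 : ∀ f → t0 (t2 f) ≡ t2 (t0 f)
    fpf02 : ∀ f → ¬ (t0 (t2 f) ≡ f)

open RibbonGraph public

iter : {A : Set} → (A → A) → ℕ → A → A
iter h zero x = x
iter h (suc k) x = h (iter h k x)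

MinPeriod : {A : Set} → (A → A) → A → ℕ → Set
MinPeriod h x k = (0 < k) × (iter h k x ≡ x) × (∀ j → 0 < j → j < k → ¬ (iter h j x ≡ x))

-- The degree of the vertex containing flag f is the least positive period of
-- the rotation t1∘t2 at f (the vertex orbit <t1,t2> of f is a cycle of
-- 2·degree flags, and t1∘t2 advances two steps along it).
Degree : {n : ℕ} → RibbonGraph n → Fin n → ℕ → Set
Degree G f d = MinPeriod (λ x → t1 G (t2 G x)) f d

Eulerian : {n : ℕ} → RibbonGraph n → Set
Eulerian G = ∀ f d → Degree G f d → 2 ∣ d

FaceStep : {n : ℕ} → RibbonGraph n → Fin n → Fin n → Set
FaceStep G x y = (y ≡ t0 G x) ⊎ (y ≡ t1 G x)

SameFace : {n : ℕ} → RibbonGraph n → Fin n → Fin n → Set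
SameFace G = Star (FaceStep G)

-- Checkerboard colourable: a red/blue colouring of the faces (a colouring of
-- flags constant on faces) such that for every edge the faces containing its
-- two edge line segments {f, t0 f} and {t2 f, t0 (t2 f)} get different colours.
CheckerboardColourable : {n : ℕ} → RibbonGraph n → Set
CheckerboardColourable {n} G =
  Σ (Fin n → Bool) λ c →
    (∀ f g → SameFace G f g → c f ≡ c g) × (∀ f → ¬ (c f ≡ c (t2 G f)))

record EdgeSubset {n : ℕ} (G : RibbonGraph n) : Set where
  field
    mem : Fin n → Bool
    mem-t0 : ∀ f → mem (t0 G f) ≡ mem f
    mem-t2 : ∀ f → mem (t2 G f) ≡ mem f

open EdgeSubset public

-- Partial Petrial: adding a half-twist to each edge in A replaces t0 by
-- t0∘t2 on the flags of those edges.
module _ {n : ℕ} (G : RibbonGraph n) (A : EdgeSubset G) where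
  private
    T0 T2 : Fin n → Fin n
    T0 = t0 G
    T2 = t2 G

  pt0 : Fin n → Fin n
  pt0 f = if mem A f then T2 (T0 f) else T0 f

  private
    lemT : ∀ f → mem A f ≡ true → pt0 f ≡ T2 (T0 f)
    lemT f e rewrite e = refl
    lemF : ∀ f → mem A f ≡ false → pt0 f ≡ T0 f
    lemF f e rewrite e = refl
    memTT : ∀ f → mem A (T2 (T0 f)) ≡ mem A f
    memTT f = trans (mem-t2 A (T0 f)) (mem-t0 A f)

    t2t0t2t0 : ∀ f → T2 (T0 (T2 (T0 f))) ≡ f
    t2t0t2t0 f = trans (cong T2 (comm02 G (T0 f)))
                   (trans (inv2 G (T0 (T0 f))) (inv0 G f))

  pinv0 : ∀ f → pt0 (pt0 f) ≡ f
  pinv0 f with mem A f in e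
  ... | true  = trans (lemT (T2 (T0 f)) (trans (memTT f) e)) (t2t0t2t0 f)
  ... | false = trans (lemF (T0 f) (trans (mem-t0 A f) e)) (inv0 G f)

  pfpf0 : ∀ f → ¬ (pt0 f ≡ f)
  pfpf0 f with mem A f
  ... | true  = λ p → fpf02 G f (trans (comm02 G f) p)
  ... | false = fpf0 G f

  pcomm02 : ∀ f → pt0 (T2 f) ≡ T2 (pt0 f)
  pcomm02 f with mem A f in e
  ... | true  = trans (lemT (T2 f) (trans (mem-t2 A f) e)) (cong T2 (comm02 G f))
  ... | false = trans (lemF (T2 f) (trans (mem-t2 A f) e)) (comm02 G f)

  pfpf02 : ∀ f → ¬ (pt0 (T2 f) ≡ f)
  pfpf02 f with mem A f in e
  ... | true  = λ p → fpf0 G f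
                 (trans (sym (cong T0 (inv2 G f)))
                 (trans (comm02 G (T2 f))
                 (trans (sym (lemT (T2 f) (trans (mem-t2 A f) e))) p)))
  ... | false = λ p → fpf02 G f (trans (sym (lemF (T2 f) (trans (mem-t2 A f) e))) p)

  partialPetrial : RibbonGraph n
  partialPetrial = record
    { t0 = pt0 ; t1 = t1 G ; t2 = t2 G
    ; inv0 = pinv0 ; inv1 = inv1 G ; inv2 = inv2 G
    ; fpf0 = pfpf0 ; fpf1 = fpf1 G ; fpf2 = fpf2 G
    ; comm02 = pcomm02 ; fpf02 = pfpf02 }

-- Colour the flags so that t1 keeps the colour and t2 flips it.  Around a
-- vertex of degree d the flags form a 2d-cycle alternating t2 and t1 steps,
-- so this is possible exactly when d is even.  Concretely, the vertex
-- consists of two orbits of the rotation t1 ∘ t2, each of length d, which t2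
-- swaps: the orbit with the smaller label (least flag index) is coloured by
-- the parity of the distance to its least flag, and the other one is then
-- forced through t2.  Twisting exactly the edges along which t0 changes the
-- colour makes t0 colour-preserving as well, so in the partial Petrial the
-- colour is constant on faces and differs on the two sides of every edge.

module Submission where

open import Defs
open import Data.Bool using (Bool; true; false; not; _xor_; if_then_else_)
open import Data.Bool.Properties
  using (not-involutive; not-¬; xor-comm; xor-assoc; xor-same; xor-annihilates-not;
         if-float; if-not; if-cong; if-cong₂; if-cong-else)
open import Data.Empty using (⊥-elim)
open import Data.Fin using (Fin; toℕ)
open import Data.Fin.Properties using (pigeonhole; toℕ-injective) renaming (_≟_ to _≟ᶠ_)
open import Data.Nat using (ℕ; zero; suc; _+_; _*_; _∸_; _<_; _≤_; z<s; s≤s; s≤s⁻¹; NonZero)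
open import Data.Nat.Properties
open import Data.Nat.DivMod using (_%_; _/_; m≡m%n+[m/n]*n; m%n<n)
open import Data.Nat.Divisibility using (_∣_; divides; ∣-trans; m%n≡0⇒n∣m)
open import Data.Product using (Σ; ∃; ∃-syntax; _×_; _,_; proj₁; proj₂)
open import Data.Sum using (inj₁; inj₂)
open import Function using (_∘_)
open import Level using (0ℓ)
open import Relation.Binary.Construct.Closure.ReflexiveTransitive using (ε; _◅_)
open import Relation.Binary.Definitions using (tri<; tri≈; tri>)
open import Relation.Binary.PropositionalEquality
open import Relation.Nullary using (¬_; does; yes; no)
open import Relation.Nullary.Decidable using (map′; dec-true; dec-false)
open import Relation.Unary using (Pred; Decidable; _⊆_)

module _ {A : Set} (h : A → A) where

  iter-+ : ∀ m n x → iter h (m + n) x ≡ iter h m (iter h n x)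
  iter-+ zero    n x = refl
  iter-+ (suc m) n x = cong h (iter-+ m n x)

  iter-suc-inner : ∀ m x → iter h (suc m) x ≡ iter h m (h x)
  iter-suc-inner m x = trans (cong (λ k → iter h k x) (+-comm 1 m)) (iter-+ m 1 x)

  iter-injective : (∀ {x y} → h x ≡ h y → x ≡ y) → ∀ m {x y} → iter h m x ≡ iter h m y → x ≡ y
  iter-injective h-injective zero    eq = eq
  iter-injective h-injective (suc m) eq = iter-injective h-injective m (h-injective eq)

  iter-*-period : ∀ {p x} → iter h p x ≡ x → ∀ q → iter h (q * p) x ≡ x
  iter-*-period         period zero    = refl
  iter-*-period {p} {x} period (suc q) = begin
    iter h (p + q * p) x          ≡⟨ iter-+ p (q * p) x ⟩
    iter h p (iter h (q * p) x)   ≡⟨ cong (iter h p) (iter-*-period period q) ⟩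
    iter h p x                    ≡⟨ period ⟩
    x                             ∎
    where open ≡-Reasoning

  iter-%-period : ∀ {p x} .{{_ : NonZero p}} → iter h p x ≡ x → ∀ e → iter h (e % p) x ≡ iter h e x
  iter-%-period {p} {x} period e = begin
    iter h (e % p) x                          ≡⟨ cong (iter h (e % p)) (sym (iter-*-period period (e / p))) ⟩
    iter h (e % p) (iter h ((e / p) * p) x)   ≡⟨ sym (iter-+ (e % p) ((e / p) * p) x) ⟩
    iter h (e % p + (e / p) * p) x            ≡⟨ cong (λ k → iter h k x) (sym (m≡m%n+[m/n]*n e p)) ⟩
    iter h e x                                ∎
    where open ≡-Reasoning

Minimal : Pred ℕ 0ℓ → ℕ → Set
Minimal P k = P k × (∀ {j} → j < k → ¬ P j)

module _ {P : Pred ℕ 0ℓ} (P? : Decidable P) where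

  minimal-below : ∀ m → ∃[ j ] j < m × P j → ∃ (Minimal P)
  minimal-below (suc m) (j , j<1+m , pj) with anyUpTo? P? m
  ... | yes below = minimal-below m below
  ... | no ¬below = j , pj , λ i<j pi → ¬below (_ , <-≤-trans i<j (s≤s⁻¹ j<1+m) , pi)

  minimal : ∀ {m} → P m → ∃ (Minimal P)
  minimal {m} pm = minimal-below (suc m) (m , ≤-refl , pm)

Minimal-unique : ∀ {P Q : Pred ℕ 0ℓ} {j k} → P ⊆ Q → Q ⊆ P → Minimal P j → Minimal Q k → j ≡ k
Minimal-unique {j = j} {k} P⊆Q Q⊆P (pj , below-j) (qk , below-k) with <-cmp j k
... | tri< j<k _ _ = ⊥-elim (below-k j<k (P⊆Q pj))
... | tri≈ _ j≡k _ = j≡k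
... | tri> _ _ k<j = ⊥-elim (below-j k<j (Q⊆P qk))

<?-flip : ∀ {a b} → a ≢ b → does (b <? a) ≡ not (does (a <? b))
<?-flip {a} {b} a≢b with <-cmp a b
... | tri< a<b _ b≮a = trans (dec-false (b <? a) b≮a) (cong not (sym (dec-true (a <? b) a<b)))
... | tri≈ _ a≡b _   = ⊥-elim (a≢b a≡b)
... | tri> a≮b _ b<a = trans (dec-true (b <? a) b<a) (cong not (sym (dec-false (a <? b) a≮b)))

isOdd : ℕ → Bool
isOdd zero    = false
isOdd (suc n) = not (isOdd n)

isOdd-even+ : ∀ {e} → 2 ∣ e → ∀ m → isOdd (e + m) ≡ isOdd m
isOdd-even+ (divides zero    refl) m = refl
isOdd-even+ (divides (suc q) refl) m =
  trans (not-involutive (isOdd (q * 2 + m))) (isOdd-even+ (divides q refl) m)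

module Orbits {n : ℕ} (h : Fin n → Fin n) (h-injective : ∀ {x y} → h x ≡ h y → x ≡ y) where

  recurrence : ∀ x → ∃[ e ] iter h (suc e) x ≡ x
  recurrence x with pigeonhole (n<1+n n) (λ i → iter h (toℕ i) x)
  ... | i , j , i<j , eq = d , sym (iter-injective h h-injective (toℕ i) (begin
      iter h (toℕ i) x                        ≡⟨ eq ⟩
      iter h (toℕ j) x                        ≡⟨ cong (λ k → iter h k x) j≡i+1+d ⟩
      iter h (toℕ i + suc d) x                ≡⟨ iter-+ h (toℕ i) (suc d) x ⟩
      iter h (toℕ i) (iter h (suc d) x)       ∎))
    where
      open ≡-Reasoning
      d : ℕ
      d = toℕ j ∸ suc (toℕ i)
      j≡i+1+d : toℕ j ≡ toℕ i + suc d
      j≡i+1+d = trans (sym (m+[n∸m]≡n i<j)) (sym (+-suc (toℕ i) d))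

  private opaque
    leastRecurrence : ∀ x → ∃ (Minimal (λ e → iter h (suc e) x ≡ x))
    leastRecurrence x = minimal (λ e → iter h (suc e) x ≟ᶠ x) {proj₁ (recurrence x)} (proj₂ (recurrence x))

  order : Fin n → ℕ
  order x = suc (proj₁ (leastRecurrence x))

  order-minPeriod : ∀ x → MinPeriod h x (order x)
  order-minPeriod x with leastRecurrence x
  ... | e , recur , below = z<s , recur , not-period
    where
      not-period : ∀ j → 0 < j → j < suc e → ¬ iter h j x ≡ x
      not-period (suc j) _ (s≤s j<e) = below j<e

  iter-order : ∀ x → iter h (order x) x ≡ x
  iter-order x = proj₁ (proj₂ (order-minPeriod x))

  order∣period : ∀ {x e} → iter h e x ≡ x → order x ∣ e
  order∣period {x} {e} recur =
    m%n≡0⇒n∣m e (order x) (below-order (m%n<n e (order x)) (trans (iter-%-period h (iter-order x) e) recur))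
    where
      below-order : ∀ {j} → j < order x → iter h j x ≡ x → j ≡ 0
      below-order {zero}  _   _     = refl
      below-order {suc j} j<o recur = ⊥-elim (proj₂ (proj₂ (order-minPeriod x)) (suc j) z<s j<o recur)

  _↝_ : Fin n → Fin n → Set
  x ↝ y = ∃[ e ] iter h e x ≡ y

  ↝-trans : ∀ {x y z} → x ↝ y → y ↝ z → x ↝ z
  ↝-trans {x} (d , refl) (e , refl) = e + d , iter-+ h e d x

  ↝-sym : ∀ {x y} → x ↝ y → y ↝ x
  ↝-sym {x} (e , refl) = e * proj₁ (leastRecurrence x) , (begin
    iter h (e * p) (iter h e x)   ≡⟨ sym (iter-+ h (e * p) e x) ⟩
    iter h (e * p + e) x          ≡⟨ cong (λ k → iter h k x) (trans (+-comm (e * p) e) (sym (*-suc e p))) ⟩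
    iter h (e * suc p) x          ≡⟨ iter-*-period h (iter-order x) e ⟩
    x                             ∎)
    where
      open ≡-Reasoning
      p : ℕ
      p = proj₁ (leastRecurrence x)

  OrbitIndex : Fin n → Pred ℕ 0ℓ
  OrbitIndex x k = ∃[ e ] toℕ (iter h e x) ≡ k

  orbitIndex? : ∀ x → Decidable (OrbitIndex x)
  orbitIndex? x k = map′ (λ (e , _ , eq) → e , eq) bounded
    (anyUpTo? (λ e → toℕ (iter h e x) ≟ k) (order x))
    where
      bounded : OrbitIndex x k → ∃[ e ] e < order x × toℕ (iter h e x) ≡ k
      bounded (e , eq) = e % order x , m%n<n e (order x) , trans (cong toℕ (iter-%-period h (iter-order x) e)) eq

  OrbitIndex-↝ : ∀ {x y} → x ↝ y → OrbitIndex y ⊆ OrbitIndex x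
  OrbitIndex-↝ x↝y (e , eq) = proj₁ (↝-trans x↝y (e , refl)) , trans (cong toℕ (proj₂ (↝-trans x↝y (e , refl)))) eq

  private opaque
    leastIndex : ∀ x → ∃ (Minimal (OrbitIndex x))
    leastIndex x = minimal (orbitIndex? x) {toℕ x} (0 , refl)

  label : Fin n → ℕ
  label x = proj₁ (leastIndex x)

  distance : Fin n → ℕ
  distance x = proj₁ (proj₁ (proj₂ (leastIndex x)))

  toℕ-iter-distance : ∀ x → toℕ (iter h (distance x) x) ≡ label x
  toℕ-iter-distance x = proj₂ (proj₁ (proj₂ (leastIndex x)))

  label-cong : ∀ {x y} → x ↝ y → label x ≡ label y
  label-cong x↝y = Minimal-unique (OrbitIndex-↝ (↝-sym x↝y)) (OrbitIndex-↝ x↝y)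
    (proj₂ (leastIndex _)) (proj₂ (leastIndex _))

  label-injective : ∀ {x y} → label x ≡ label y → x ↝ y
  label-injective {x} {y} eq = ↝-trans (distance x , meet) (↝-sym (distance y , refl))
    where
      meet : iter h (distance x) x ≡ iter h (distance y) y
      meet = toℕ-injective (trans (toℕ-iter-distance x) (trans eq (sym (toℕ-iter-distance y))))

  module EvenPeriods (even-period : ∀ x d → MinPeriod h x d → 2 ∣ d) where

    isOdd-≤-cong : ∀ {x a b} → a ≤ b → iter h a x ≡ iter h b x → isOdd b ≡ isOdd a
    isOdd-≤-cong {x} {a} {b} a≤b eq = begin
      isOdd b         ≡⟨ cong isOdd (sym (m∸n+n≡m a≤b)) ⟩
      isOdd (d + a)   ≡⟨ isOdd-even+ (∣-trans (even-period y (order y) (order-minPeriod y)) (order∣period {y} {d} period)) a ⟩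
      isOdd a         ∎
      where
        open ≡-Reasoning
        d : ℕ
        d = b ∸ a
        y : Fin n
        y = iter h a x
        period : iter h d y ≡ y
        period = trans (sym (iter-+ h d a x)) (trans (cong (λ k → iter h k x) (m∸n+n≡m a≤b)) (sym eq))

    isOdd-cong : ∀ {x a b} → iter h a x ≡ iter h b x → isOdd a ≡ isOdd b
    isOdd-cong {a = a} {b} eq with ≤-total a b
    ... | inj₁ a≤b = sym (isOdd-≤-cong a≤b eq)
    ... | inj₂ b≤a = isOdd-≤-cong b≤a (sym eq)

    side : Fin n → Bool
    side x = isOdd (distance x)

    side-h : ∀ x → side (h x) ≡ not (side x)
    side-h x = trans (sym (not-involutive (side (h x)))) (cong not (isOdd-cong {x} {suc (distance (h x))} {distance x} same-end))
      where
        open ≡-Reasoning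
        same-end : iter h (suc (distance (h x))) x ≡ iter h (distance x) x
        same-end = toℕ-injective (begin
          toℕ (iter h (suc (distance (h x))) x)   ≡⟨ cong toℕ (iter-suc-inner h (distance (h x)) x) ⟩
          toℕ (iter h (distance (h x)) (h x))     ≡⟨ toℕ-iter-distance (h x) ⟩
          label (h x)                             ≡⟨ label-cong (↝-sym (1 , refl)) ⟩
          label x                                 ≡⟨ sym (toℕ-iter-distance x) ⟩
          toℕ (iter h (distance x) x)             ∎)

    module Reversal (σ : Fin n → Fin n) (σ-involutive : ∀ x → σ (σ x) ≡ x)
             (σ-reverses-h : ∀ x → h (σ (h x)) ≡ σ x)
             (σ-leaves-orbit : ∀ x → ¬ x ↝ σ x) where

      leads : Fin n → Bool
      leads x = does (label x <? label (σ x))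

      leads-σ : ∀ x → leads (σ x) ≡ not (leads x)
      leads-σ x = trans (cong (λ y → does (label (σ x) <? label y)) (σ-involutive x))
        (<?-flip (σ-leaves-orbit x ∘ label-injective))

      leads-h : ∀ x → leads (h x) ≡ leads x
      leads-h x = cong₂ (λ a b → does (a <? b))
        (label-cong (↝-sym (1 , refl)))
        (label-cong (1 , σ-reverses-h x))

      side-σ-h : ∀ x → side (σ (h x)) ≡ not (side (σ x))
      side-σ-h x = trans (sym (not-involutive (side (σ (h x)))))
        (cong not (sym (trans (cong side (sym (σ-reverses-h x))) (side-h (σ (h x))))))

      colour : Fin n → Bool
      colour x = if leads x then side x else not (side (σ x))

      colour-σ : ∀ x → colour (σ x) ≡ not (colour x)
      colour-σ x = begin
        colour (σ x)                                              ≡⟨ cong₂ (λ p y → if p then side (σ x) else not (side y))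
                                                                           (leads-σ x) (σ-involutive x) ⟩
        (if not (leads x) then side (σ x) else not (side x))      ≡⟨ if-not (leads x) ⟩
        (if leads x then not (side x) else side (σ x))            ≡⟨ if-cong-else (leads x) (sym (not-involutive (side (σ x)))) ⟩
        (if leads x then not (side x) else not (not (side (σ x)))) ≡⟨ sym (if-float not (leads x)) ⟩
        not (colour x)                                            ∎
        where open ≡-Reasoning

      colour-h : ∀ x → colour (h x) ≡ not (colour x)
      colour-h x = begin
        colour (h x)                                               ≡⟨ if-cong (leads-h x) ⟩
        (if leads x then side (h x) else not (side (σ (h x))))     ≡⟨ if-cong₂ (leads x) (side-h x) (cong not (side-σ-h x)) ⟩
        (if leads x then not (side x) else not (not (side (σ x)))) ≡⟨ sym (if-float not (leads x)) ⟩
        not (colour x)                                             ∎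
        where open ≡-Reasoning

module _ {A : Set} (a b : A → A) (a-involutive : ∀ x → a (a x) ≡ x) (b-involutive : ∀ x → b (b x) ≡ x) where

  b-reverses-a∘b : ∀ x → (a ∘ b) (b ((a ∘ b) x)) ≡ b x
  b-reverses-a∘b x = trans (cong a (b-involutive (a (b x)))) (a-involutive (b x))

  a∘b-injective : ∀ {x y} → (a ∘ b) x ≡ (a ∘ b) y → x ≡ y
  a∘b-injective {x} {y} eq = begin
    x                         ≡⟨ sym (b-involutive x) ⟩
    b (b x)                   ≡⟨ cong b (sym (b-reverses-a∘b x)) ⟩
    b (a (b (b (a (b x)))))   ≡⟨ cong (λ z → b (a (b (b z)))) eq ⟩
    b (a (b (b (a (b y)))))   ≡⟨ cong b (b-reverses-a∘b y) ⟩
    b (b y)                   ≡⟨ b-involutive y ⟩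
    y                         ∎
    where open ≡-Reasoning

  a∘b-orbit-avoids-b : (∀ x → a x ≢ x) → (∀ x → b x ≢ x) → ∀ e x → iter (a ∘ b) e x ≢ b x
  a∘b-orbit-avoids-b a-fpf b-fpf zero          x eq = b-fpf x (sym eq)
  a∘b-orbit-avoids-b a-fpf b-fpf (suc zero)    x eq = a-fpf (b x) eq
  a∘b-orbit-avoids-b a-fpf b-fpf (suc (suc e)) x eq =
    a∘b-orbit-avoids-b a-fpf b-fpf e ((a ∘ b) x) (a∘b-injective (begin
      (a ∘ b) (iter (a ∘ b) e ((a ∘ b) x))   ≡⟨ cong (a ∘ b) (sym (iter-suc-inner (a ∘ b) e x)) ⟩
      iter (a ∘ b) (suc (suc e)) x           ≡⟨ eq ⟩
      b x                                    ≡⟨ sym (b-reverses-a∘b x) ⟩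
      (a ∘ b) (b ((a ∘ b) x))                ∎))
    where open ≡-Reasoning

module _ {n : ℕ} (G : RibbonGraph n) where

  eulerian⇒flagColouring : Eulerian G →
    Σ (Fin n → Bool) λ c → (∀ f → c (t1 G f) ≡ c f) × (∀ f → c (t2 G f) ≡ not (c f))
  eulerian⇒flagColouring eulerian = colour , colour-t1 , colour-σ
    where
      open Orbits (t1 G ∘ t2 G) (a∘b-injective (t1 G) (t2 G) (inv1 G) (inv2 G))
      open EvenPeriods eulerian
      open Reversal (t2 G) (inv2 G) (b-reverses-a∘b (t1 G) (t2 G) (inv1 G) (inv2 G))
        (λ x (e , eq) → a∘b-orbit-avoids-b (t1 G) (t2 G) (inv1 G) (inv2 G) (fpf1 G) (fpf2 G) e x eq)

      colour-t1 : ∀ f → colour (t1 G f) ≡ colour f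
      colour-t1 f = begin
        colour (t1 G f)                ≡⟨ cong (colour ∘ t1 G) (sym (inv2 G f)) ⟩
        colour (t1 G (t2 G (t2 G f)))  ≡⟨ colour-h (t2 G f) ⟩
        not (colour (t2 G f))          ≡⟨ cong not (colour-σ f) ⟩
        not (not (colour f))           ≡⟨ not-involutive (colour f) ⟩
        colour f                       ∎
        where open ≡-Reasoning

  module _ (c : Fin n → Bool) (c-t1 : ∀ f → c (t1 G f) ≡ c f) (c-t2 : ∀ f → c (t2 G f) ≡ not (c f)) where

    colourChangingEdges : EdgeSubset G
    colourChangingEdges = record
      { mem    = λ f → c (t0 G f) xor c f
      ; mem-t0 = λ f → trans (cong (λ g → c g xor c (t0 G f)) (inv0 G f)) (xor-comm (c f) (c (t0 G f)))
      ; mem-t2 = λ f → trans (cong₂ _xor_ (trans (cong c (comm02 G f)) (c-t2 (t0 G f))) (c-t2 f))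
                             (xor-annihilates-not (c (t0 G f)) (c f))
      }

    c-twist : ∀ m f → c (if m then t2 G f else f) ≡ m xor c f
    c-twist true  f = c-t2 f
    c-twist false f = refl

    c-pt0 : ∀ f → c (pt0 G colourChangingEdges f) ≡ c f
    c-pt0 f = begin
      c (pt0 G colourChangingEdges f)     ≡⟨ c-twist (c₀ xor c f) (t0 G f) ⟩
      (c₀ xor c f) xor c₀                 ≡⟨ xor-comm (c₀ xor c f) c₀ ⟩
      c₀ xor (c₀ xor c f)                 ≡⟨ sym (xor-assoc c₀ c₀ (c f)) ⟩
      (c₀ xor c₀) xor c f                 ≡⟨ cong (_xor c f) (xor-same c₀) ⟩
      c f                                 ∎
      where
        open ≡-Reasoning
        c₀ : Bool
        c₀ = c (t0 G f)

    c-sameFace : ∀ {f g} → SameFace (partialPetrial G colourChangingEdges) f g → c f ≡ c g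
    c-sameFace ε                  = refl
    c-sameFace (inj₁ refl ◅ path) = trans (sym (c-pt0 _)) (c-sameFace path)
    c-sameFace (inj₂ refl ◅ path) = trans (sym (c-t1 _)) (c-sameFace path)

    partialPetrial-checkerboard : CheckerboardColourable (partialPetrial G colourChangingEdges)
    partialPetrial-checkerboard = c , (λ _ _ → c-sameFace) , λ f eq → not-¬ refl (trans eq (c-t2 f))

theorem2 : {n : ℕ} (G : RibbonGraph n) → Eulerian G →
    Σ (EdgeSubset G) λ I → CheckerboardColourable (partialPetrial G I)
theorem2 G eulerian with eulerian⇒flagColouring G eulerian
... | c , c-t1 , c-t2 = colourChangingEdges G c c-t1 c-t2 , partialPetrial-checkerboard G c c-t1 c-t2
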